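{- Let $\mathbb{Z}_2^n$ denote the elementary abelian group $(\{0,1\}^n, +)$ with componentwise addition modulo 2, and let $F_n = \mathbb{Z}_2^n \setminus \{0\}$. For any integer $n \geq 2$, there exists a permutation $(v_1, v_2, \ldots, v_{2^n-1})$ of $F_n$ such that $v_{i-1} + v_i + v_{i+1} = 0$ for every $i \in \{2, 4, \ldots, 2^n - 2\}$ if and only if $n \notin \{3, 4\}$.
   Context: Such a permutation is called ternary, and $\mathbb{Z}_2^n$ is called sequentially ternary when a ternary permutation of $F_n$ exists. Equivalently, for a set $X$ with $|X| = n$, this asks for an ordering $(A_1, \ldots, A_{2^n-1})$ of all nonempty subsets of $X$ with $A_{j-1} \triangle A_j \triangle A_{j+1} = \emptyset$ for each even $j < 2^n - 1$. -}

module Defs where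

open import Data.Nat using (ℕ; zero; suc; _+_; _*_; _∸_; _^_; _<_; _≤_)
open import Data.Bool using (Bool; false; _xor_)
open import Data.Vec using (Vec; zipWith; replicate)
open import Data.Fin using (Fin; fromℕ<)
open import Data.Product using (Σ; ∃; _×_; _,_)
open import Relation.Binary.PropositionalEquality using (_≡_)
open import Relation.Nullary using (¬_)
open import Function.Definitions using (Injective)

Z2^ : ℕ → Set
Z2^ n = Vec Bool n

_⊕_ : {n : ℕ} → Z2^ n → Z2^ n → Z2^ n
_⊕_ = zipWith _xor_

infixl 6 _⊕_

𝟎 : {n : ℕ} → Z2^ n
𝟎 {n} = replicate n false

InF : {n : ℕ} → Z2^ n → Set
InF v = ¬ (v ≡ 𝟎)

-- A permutation (v_1, ..., v_{2^n - 1}) of F_n, stored 0-indexed: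
-- v (fromℕ< p) is v_{j+1} for j < 2^n - 1.  It is a bijection from
-- Fin (2^n - 1) onto F_n: injective, lands in F_n, hits every element of F_n.
IsPermutationOfF : (n : ℕ) → (Fin (2 ^ n ∸ 1) → Z2^ n) → Set
IsPermutationOfF n v =
  Injective _≡_ _≡_ v
  × (∀ j → InF (v j))
  × (∀ (w : Z2^ n) → InF w → ∃ λ j → v j ≡ w)

-- Ternary condition: v_{i-1} + v_i + v_{i+1} = 0 for every even i with
-- 2 ≤ i ≤ 2^n - 2.  Writing i = 2k + 2 (k ≥ 0), in 0-indexed terms this is
-- positions 2k, 2k+1, 2k+2, for all k with 2k + 2 < 2^n - 1.
IsTernary : (n : ℕ) → (Fin (2 ^ n ∸ 1) → Z2^ n) → Set
IsTernary n v =
  ∀ (k : ℕ) (p₀ : 2 * k < 2 ^ n ∸ 1) (p₁ : 2 * k + 1 < 2 ^ n ∸ 1)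
    (p₂ : 2 * k + 2 < 2 ^ n ∸ 1) →
    v (fromℕ< p₀) ⊕ v (fromℕ< p₁) ⊕ v (fromℕ< p₂) ≡ 𝟎

SequentiallyTernary : ℕ → Set
SequentiallyTernary n =
  Σ (Fin (2 ^ n ∸ 1) → Z2^ n) λ v → IsPermutationOfF n v × IsTernary n v

-- A ternary permutation is determined by its odd-position terms u₁, u₂, …, u_(2^(n-1)),
-- since the even-position terms are forced to be the sums uᵢ ⊕ uᵢ₊₁; call such a list a
-- skeleton when u₁, u₁ ⊕ u₂, u₂, … enumerates F_n. Skeletons for n = 2, 5, 6, 7 are checked by
-- evaluation, and a product construction turns a skeleton U of Z2^D into one of Z2^(D+3):
-- traverse eight layers, the k-th being U with the k-th entries of the columns
-- Lcol, Mcol, Ccol, …, Rcol of vectors in Z2^3 prefixed, alternately backwards and forwards.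
-- Consecutive sums of these columns list Z2^3, so the layers produce each l ++ x with x ∈ F_D
-- exactly once, except for x = u₁, where Lcol repeats two prefixes and misses two others;
-- dropping the repeats, the sums at the junctions between layers and a two-element gadget
-- supply the missing l ++ u₁ and all l ++ 𝟎 with l ≠ 𝟎.
-- For n = 3 and n = 4 an exhaustive search, after moving v₁ to e₁ by a linear automorphism
-- when n = 4, shows that no ternary permutation exists.

module Submission where

open import Defs
open import Data.Nat using (ℕ; zero; suc; pred; _+_; _*_; _∸_; _^_; _<_; _≤_; z≤n; s≤s; s≤s⁻¹; _≡ᵇ_; _%_; _/_)
open import Data.Nat.Properties
open import Data.Nat.Tactic.RingSolver using (solve-∀)
open import Data.Nat.ListAction using (sum)
open import Data.Bool using (Bool; true; false; not; _∧_; _∨_; _xor_; T)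
open import Data.Bool.Properties using (xor-assoc; xor-comm; xor-identityˡ; xor-identityʳ; xor-same; xor-∧-commutativeRing; ∧-conicalˡ; ∧-conicalʳ; ∧-zeroʳ; ∧-identityʳ; ∧-distribˡ-xor; ∨-zeroʳ; not-involutive)
open import Algebra.Bundles using (CommutativeRing)
open import Algebra.Properties.CommutativeSemigroup (CommutativeRing.+-commutativeSemigroup xor-∧-commutativeRing) using (interchange)
open import Algebra.Properties.CommutativeMonoid.Sum +-0-commutativeMonoid using (sum-syntax; ∑-distrib-+; sum-cong-≗; sum-replicate-zero) renaming (sum to ∑)
open import Data.Vec as V using (Vec; []; _∷_; lookup)
open import Data.Vec.Properties using (zipWith-assoc; zipWith-comm; zipWith-identityˡ; zipWith-identityʳ; zipWith-++; lookup-zipWith)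
open import Data.List as L using (List; []; _∷_; _++_; _∷ʳ_; length; reverse; concat; map; tabulate)
open import Data.List.Properties using (unfold-reverse; ++-assoc; ++-identityʳ; length-map; length-++; length-reverse; length-tabulate)
open import Data.List.Relation.Unary.All using (All; []; _∷_)
open import Data.Fin using (Fin; zero; suc; toℕ; fromℕ<; #_)
open import Data.Fin.Properties as Fin using (toℕ-injective; toℕ-fromℕ<; toℕ<n)
open import Data.Product using (∃; ∃₂; _×_; _,_; proj₁; proj₂)
open import Data.Empty using (⊥; ⊥-elim)
open import Data.Unit using (tt)
open import Function using (_∘_)
open import Function.Bundles using (_⇔_; mk⇔)
open import Function.Definitions using (Injective)
open import Relation.Binary.PropositionalEquality
open import Relation.Nullary using (¬_; contradiction)

⊕-assoc : ∀ {n} (x y z : Z2^ n) → x ⊕ y ⊕ z ≡ x ⊕ (y ⊕ z)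
⊕-assoc = zipWith-assoc xor-assoc

⊕-comm : ∀ {n} (x y : Z2^ n) → x ⊕ y ≡ y ⊕ x
⊕-comm = zipWith-comm xor-comm

⊕-identityˡ : ∀ {n} (x : Z2^ n) → 𝟎 ⊕ x ≡ x
⊕-identityˡ = zipWith-identityˡ xor-identityˡ

⊕-identityʳ : ∀ {n} (x : Z2^ n) → x ⊕ 𝟎 ≡ x
⊕-identityʳ = zipWith-identityʳ xor-identityʳ

⊕-self : ∀ {n} (x : Z2^ n) → x ⊕ x ≡ 𝟎
⊕-self []      = refl
⊕-self (b ∷ x) = cong₂ _∷_ (xor-same b) (⊕-self x)

⊕-++ : ∀ {m n} (a b : Z2^ m) (x y : Z2^ n) → (a V.++ x) ⊕ (b V.++ y) ≡ (a ⊕ b) V.++ (x ⊕ y)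
⊕-++ a b x y = zipWith-++ _ a x b y

x⊕[x⊕y]⊕y≡𝟎 : ∀ {n} (x y : Z2^ n) → x ⊕ (x ⊕ y) ⊕ y ≡ 𝟎
x⊕[x⊕y]⊕y≡𝟎 x y = begin
  x ⊕ (x ⊕ y) ⊕ y  ≡⟨ cong (_⊕ y) (⊕-assoc x x y) ⟨
  x ⊕ x ⊕ y ⊕ y    ≡⟨ cong (λ z → z ⊕ y ⊕ y) (⊕-self x) ⟩
  𝟎 ⊕ y ⊕ y        ≡⟨ cong (_⊕ y) (⊕-identityˡ y) ⟩
  y ⊕ y            ≡⟨ ⊕-self y ⟩
  𝟎                ∎
  where open ≡-Reasoning

⊕≡𝟎⇒≡ : ∀ {n} (x y : Z2^ n) → x ⊕ y ≡ 𝟎 → x ≡ y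
⊕≡𝟎⇒≡ x y x⊕y≡𝟎 = begin
  x            ≡⟨ ⊕-identityʳ x ⟨
  x ⊕ 𝟎        ≡⟨ cong (x ⊕_) (⊕-self y) ⟨
  x ⊕ (y ⊕ y)  ≡⟨ ⊕-assoc x y y ⟨
  x ⊕ y ⊕ y    ≡⟨ cong (_⊕ y) x⊕y≡𝟎 ⟩
  𝟎 ⊕ y        ≡⟨ ⊕-identityˡ y ⟩
  y            ∎
  where open ≡-Reasoning

middle-of-triple : ∀ {n} (a b c : Z2^ n) → a ⊕ b ⊕ c ≡ 𝟎 → b ≡ a ⊕ c
middle-of-triple a b c a⊕b⊕c≡𝟎 = begin
  b            ≡⟨ ⊕-identityˡ b ⟨
  𝟎 ⊕ b        ≡⟨ cong (_⊕ b) (⊕-self a) ⟨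
  a ⊕ a ⊕ b    ≡⟨ ⊕-assoc a a b ⟩
  a ⊕ (a ⊕ b)  ≡⟨ cong (a ⊕_) (⊕≡𝟎⇒≡ (a ⊕ b) c a⊕b⊕c≡𝟎) ⟩
  a ⊕ c        ∎
  where open ≡-Reasoning

same-suffix : ∀ {m n} (a b : Z2^ m) (y : Z2^ n) → (a V.++ y) ⊕ (b V.++ y) ≡ (a ⊕ b) V.++ 𝟎
same-suffix a b y = trans (⊕-++ a b y y) (cong ((a ⊕ b) V.++_) (⊕-self y))

𝟎-suffixʳ : ∀ {m n} (a b : Z2^ m) (y : Z2^ n) → (a V.++ y) ⊕ (b V.++ 𝟎) ≡ (a ⊕ b) V.++ y
𝟎-suffixʳ a b y = trans (⊕-++ a b y 𝟎) (cong ((a ⊕ b) V.++_) (⊕-identityʳ y))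

𝟎-suffixˡ : ∀ {m n} (a b : Z2^ m) (y : Z2^ n) → (a V.++ 𝟎) ⊕ (b V.++ y) ≡ (a ⊕ b) V.++ y
𝟎-suffixˡ a b y = trans (⊕-++ a b 𝟎 y) (cong ((a ⊕ b) V.++_) (⊕-identityˡ y))

infix 5 _==_

_==_ : ∀ {n} → Z2^ n → Z2^ n → Bool
[]          == []          = true
(true ∷ x)  == (true ∷ y)  = x == y
(false ∷ x) == (false ∷ y) = x == y
(true ∷ _)  == (false ∷ _) = false
(false ∷ _) == (true ∷ _)  = false

==⇒≡ : ∀ {n} (x y : Z2^ n) → x == y ≡ true → x ≡ y
==⇒≡ []          []          _  = refl
==⇒≡ (true ∷ x)  (true ∷ y)  eq = cong (true ∷_) (==⇒≡ x y eq)
==⇒≡ (false ∷ x) (false ∷ y) eq = cong (false ∷_) (==⇒≡ x y eq)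

==-refl : ∀ {n} (x : Z2^ n) → x == x ≡ true
==-refl []          = refl
==-refl (true ∷ x)  = ==-refl x
==-refl (false ∷ x) = ==-refl x

≢⇒==false : ∀ {n} {x y : Z2^ n} → ¬ x ≡ y → x == y ≡ false
≢⇒==false {x = x} {y} x≢y with x == y in eq
... | true  = ⊥-elim (x≢y (==⇒≡ x y eq))
... | false = refl

==-++ : ∀ {m n} (a b : Z2^ m) (x y : Z2^ n) → (a V.++ x) == (b V.++ y) ≡ (a == b) ∧ (x == y)
==-++ []          []          x y = refl
==-++ (true ∷ a)  (true ∷ b)  x y = ==-++ a b x y
==-++ (false ∷ a) (false ∷ b) x y = ==-++ a b x y
==-++ (true ∷ a)  (false ∷ b) x y = refl
==-++ (false ∷ a) (true ∷ b)  x y = refl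

𝟙 : Bool → ℕ
𝟙 true  = 1
𝟙 false = 0

𝟙≤1 : ∀ b → 𝟙 b ≤ 1
𝟙≤1 true  = s≤s z≤n
𝟙≤1 false = z≤n

𝟙-∧ : ∀ a b → 𝟙 (a ∧ b) ≡ 𝟙 b * 𝟙 a
𝟙-∧ true  true  = refl
𝟙-∧ true  false = refl
𝟙-∧ false true  = refl
𝟙-∧ false false = refl

count : ∀ {n} → Z2^ n → List (Z2^ n) → ℕ
count w []       = 0
count w (x ∷ xs) = 𝟙 (w == x) + count w xs

ListsF : ∀ {n} → List (Z2^ n) → Set
ListsF {n} xs = (w : Z2^ n) → count w xs ≡ 𝟙 (not (w == 𝟎))

Distinct : ∀ {n} → List (Z2^ n) → Set
Distinct xs = ∀ w → count w xs ≤ 1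

count-++ : ∀ {n} (w : Z2^ n) xs ys → count w (xs ++ ys) ≡ count w xs + count w ys
count-++ w []       ys = refl
count-++ w (x ∷ xs) ys =
  trans (cong (𝟙 (w == x) +_) (count-++ w xs ys)) (sym (+-assoc (𝟙 (w == x)) _ _))

count-reverse : ∀ {n} (w : Z2^ n) xs → count w (reverse xs) ≡ count w xs
count-reverse w []       = refl
count-reverse w (x ∷ xs) = begin
  count w (reverse (x ∷ xs))              ≡⟨ cong (count w) (unfold-reverse x xs) ⟩
  count w (reverse xs ∷ʳ x)               ≡⟨ count-++ w (reverse xs) (x ∷ []) ⟩
  count w (reverse xs) + (𝟙 (w == x) + 0) ≡⟨ cong₂ _+_ (count-reverse w xs) (+-identityʳ _) ⟩
  count w xs + 𝟙 (w == x)                 ≡⟨ +-comm (count w xs) _ ⟩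
  count w (x ∷ xs)                        ∎
  where open ≡-Reasoning

count-suffixed : ∀ {m n} (l : Z2^ m) (x y : Z2^ n) ps → count (l V.++ x) (map (V._++ y) ps) ≡ 𝟙 (x == y) * count l ps
count-suffixed l x y []       = sym (*-zeroʳ (𝟙 (x == y)))
count-suffixed l x y (p ∷ ps) = begin
  𝟙 ((l V.++ x) == (p V.++ y)) + count (l V.++ x) (map (V._++ y) ps)
    ≡⟨ cong₂ _+_ (trans (cong 𝟙 (==-++ l p x y)) (𝟙-∧ (l == p) (x == y))) (count-suffixed l x y ps) ⟩
  𝟙 (x == y) * 𝟙 (l == p) + 𝟙 (x == y) * count l ps
    ≡⟨ *-distribˡ-+ (𝟙 (x == y)) _ _ ⟨
  𝟙 (x == y) * count l (p ∷ ps) ∎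
  where open ≡-Reasoning

listsF-head≢𝟎 : ∀ {n} (u : Z2^ n) xs → ListsF (u ∷ xs) → ¬ u ≡ 𝟎
listsF-head≢𝟎 {n} u xs listsF u≡𝟎 = 1+n≢0 (begin
  1 + count u xs             ≡⟨ cong (λ b → 𝟙 b + count u xs) (==-refl u) ⟨
  count u (u ∷ xs)           ≡⟨ listsF u ⟩
  𝟙 (not (u == 𝟎))           ≡⟨ cong (λ y → 𝟙 (not (y == 𝟎))) u≡𝟎 ⟩
  𝟙 (not (𝟎 {n} == 𝟎))       ≡⟨ cong (𝟙 ∘ not) (==-refl (𝟎 {n})) ⟩
  0                          ∎)
  where open ≡-Reasoning

absent-after : ∀ {n} (w : Z2^ n) ys → count w (w ∷ ys) ≤ 1 → count w ys ≡ 0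
absent-after w ys h = n≤0⇒n≡0 (s≤s⁻¹ (subst (_≤ 1) (cong (λ b → 𝟙 b + count w ys) (==-refl w)) h))

absent-from-++ : ∀ {n} (w : Z2^ n) xs ys → count w (xs ++ ys) ≡ 0 → count w ys ≡ 0
absent-from-++ w xs ys h = m+n≡0⇒n≡0 (count w xs) (trans (sym (count-++ w xs ys)) h)

lastOr : ∀ {A : Set} → A → List A → A
lastOr d []       = d
lastOr d (x ∷ xs) = lastOr x xs

headOr : ∀ {A : Set} → A → List A → A
headOr d []      = d
headOr d (x ∷ _) = x

lastOr-∷ʳ : ∀ {A : Set} (d : A) xs y → lastOr d (xs ∷ʳ y) ≡ y
lastOr-∷ʳ d []       y = refl
lastOr-∷ʳ d (x ∷ xs) y = lastOr-∷ʳ x xs y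

headOr-reverse : ∀ {A : Set} (d : A) xs → headOr d (reverse xs) ≡ lastOr d xs
headOr-reverse d []       = refl
headOr-reverse d (x ∷ xs) rewrite unfold-reverse x xs with reverse xs | headOr-reverse x xs
... | []    | eq = eq
... | _ ∷ _ | eq = eq

lastOr-reverse : ∀ {A : Set} (d x : A) xs → lastOr d (reverse (x ∷ xs)) ≡ x
lastOr-reverse d x xs rewrite unfold-reverse x xs = lastOr-∷ʳ d (reverse xs) x

reverse-∷-view : ∀ {A : Set} (y : A) ys → ∃₂ λ r rs → reverse (y ∷ ys) ≡ r ∷ rs × lastOr r rs ≡ y
reverse-∷-view y ys with reverse ys | unfold-reverse y ys
... | []     | eq = y , [] , eq , refl
... | r ∷ rs | eq = r , rs ∷ʳ y , eq , lastOr-∷ʳ r rs y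

data NonEmpty {A : Set} : List A → Set where
  nonEmpty : ∀ {x xs} → NonEmpty (x ∷ xs)

reverse-nonEmpty : ∀ {A : Set} (x : A) xs → NonEmpty (reverse (x ∷ xs))
reverse-nonEmpty x xs with reverse-∷-view x xs
... | _ , _ , eq , _ rewrite eq = nonEmpty

length-concat : ∀ {A : Set} (xss : List (List A)) → length (concat xss) ≡ sum (map length xss)
length-concat []         = refl
length-concat (xs ∷ xss) = trans (length-++ xs) (cong (length xs +_) (length-concat xss))

lookupOr : ∀ {A : Set} → A → List A → ℕ → A
lookupOr d []       _       = d
lookupOr d (x ∷ xs) zero    = x
lookupOr d (x ∷ xs) (suc p) = lookupOr d xs p

lookupOr-tabulate : ∀ {A : Set} {m} (d : A) (f : Fin m → A) p (p<m : p < m) → lookupOr d (tabulate f) p ≡ f (fromℕ< p<m)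
lookupOr-tabulate d f zero    (s≤s _)   = refl
lookupOr-tabulate d f (suc p) (s≤s p<m) = lookupOr-tabulate d (f ∘ suc) p p<m

-- Filling in the even positions

module _ {A : Set} (_∙_ : A → A → A) where

  fillFrom : A → List A → List A
  fillFrom x []       = x ∷ []
  fillFrom x (y ∷ ys) = x ∷ x ∙ y ∷ fillFrom y ys

  fillWith : List A → List A
  fillWith []       = []
  fillWith (x ∷ xs) = fillFrom x xs

  length-fillFrom : ∀ x xs → length (fillFrom x xs) ≡ suc (2 * length xs)
  length-fillFrom x []       = refl
  length-fillFrom x (y ∷ ys) =
    trans (cong (2 +_) (length-fillFrom y ys)) (sym (cong suc (*-suc 2 (length ys))))

  fillFrom-++ : ∀ x xs y ys → fillFrom x (xs ++ y ∷ ys) ≡ fillFrom x xs ++ (lastOr x xs ∙ y) ∷ fillFrom y ys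
  fillFrom-++ x []       y ys = refl
  fillFrom-++ x (z ∷ zs) y ys = cong (λ t → x ∷ x ∙ z ∷ t) (fillFrom-++ z zs y ys)

  fillWith-reverse : (∀ a b → a ∙ b ≡ b ∙ a) → ∀ x xs → fillWith (reverse (x ∷ xs)) ≡ reverse (fillFrom x xs)
  fillWith-reverse comm x []       = refl
  fillWith-reverse comm x (y ∷ ys) with reverse-∷-view y ys
  ... | r , rs , eq , last≡y = begin
    fillWith (reverse (x ∷ y ∷ ys))                 ≡⟨ cong fillWith (unfold-reverse x (y ∷ ys)) ⟩
    fillWith (reverse (y ∷ ys) ∷ʳ x)                ≡⟨ cong (λ t → fillWith (t ∷ʳ x)) eq ⟩
    fillFrom r (rs ∷ʳ x)                            ≡⟨ fillFrom-++ r rs x [] ⟩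
    fillFrom r rs ++ lastOr r rs ∙ x ∷ x ∷ []        ≡⟨ cong₂ (λ s t → s ++ t ∙ x ∷ x ∷ []) (cong fillWith eq) (sym last≡y) ⟨
    fillWith (reverse (y ∷ ys)) ++ y ∙ x ∷ x ∷ []    ≡⟨ cong₂ (λ s t → s ++ t ∷ x ∷ []) (fillWith-reverse comm y ys) (comm y x) ⟩
    reverse (fillFrom y ys) ++ x ∙ y ∷ x ∷ []        ≡⟨ ++-assoc (reverse (fillFrom y ys)) (x ∙ y ∷ []) (x ∷ []) ⟨
    reverse (fillFrom y ys) ∷ʳ x ∙ y ∷ʳ x           ≡⟨ cong (_∷ʳ x) (unfold-reverse (x ∙ y) (fillFrom y ys)) ⟨
    reverse (x ∙ y ∷ fillFrom y ys) ∷ʳ x            ≡⟨ unfold-reverse x (x ∙ y ∷ fillFrom y ys) ⟨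
    reverse (fillFrom x (y ∷ ys))                   ∎
    where open ≡-Reasoning

map-fillFrom : ∀ {A B : Set} (_∙_ : A → A → A) (_∘′_ : B → B → B) (f : A → B) →
  (∀ a b → f (a ∙ b) ≡ f a ∘′ f b) → ∀ x xs → map f (fillFrom _∙_ x xs) ≡ fillFrom _∘′_ (f x) (map f xs)
map-fillFrom _∙_ _∘′_ f hom x []       = refl
map-fillFrom _∙_ _∘′_ f hom x (y ∷ ys) = cong₂ (λ s t → f x ∷ s ∷ t) (hom x y) (map-fillFrom _∙_ _∘′_ f hom y ys)

zipWith-fillFrom : ∀ {A B C : Set} (_∙_ : A → A → A) (_∘′_ : B → B → B) (_⋆_ : C → C → C) (h : A → B → C) →
  (∀ a a′ b b′ → h (a ∙ a′) (b ∘′ b′) ≡ h a b ⋆ h a′ b′) →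
  ∀ x xs y ys → length xs ≡ length ys →
  L.zipWith h (fillFrom _∙_ x xs) (fillFrom _∘′_ y ys) ≡ fillFrom _⋆_ (h x y) (L.zipWith h xs ys)
zipWith-fillFrom _ _ _ h hom x []        y []        _  = refl
zipWith-fillFrom _∙_ _∘′_ _⋆_ h hom x (x′ ∷ xs) y (y′ ∷ ys) eq =
  cong₂ (λ s t → h x y ∷ s ∷ t) (hom x x′ y y′) (zipWith-fillFrom _∙_ _∘′_ _⋆_ h hom x′ xs y′ ys (suc-injective eq))

fill : ∀ {n} → List (Z2^ n) → List (Z2^ n)
fill = fillWith _⊕_

count-fill-reverse : ∀ {n} (w : Z2^ n) xs → count w (fill (reverse xs)) ≡ count w (fill xs)
count-fill-reverse w []       = refl
count-fill-reverse w (x ∷ xs) =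
  trans (cong (count w) (fillWith-reverse _⊕_ ⊕-comm x xs)) (count-reverse w (fillFrom _⊕_ x xs))

count-fill-++ : ∀ {n} (w : Z2^ n) xs ys → NonEmpty xs → NonEmpty ys →
  count w (fill (xs ++ ys)) ≡ count w (fill xs) + (𝟙 (w == lastOr 𝟎 xs ⊕ headOr 𝟎 ys) + count w (fill ys))
count-fill-++ w (x ∷ xs) (y ∷ ys) nonEmpty nonEmpty =
  trans (cong (count w) (fillFrom-++ _⊕_ x xs y ys)) (count-++ w (fillFrom _⊕_ x xs) _)

junctions : ∀ {n} → List (List (Z2^ n)) → List (Z2^ n)
junctions []           = []
junctions (_ ∷ [])     = []
junctions (p ∷ q ∷ ps) = lastOr 𝟎 p ⊕ headOr 𝟎 q ∷ junctions (q ∷ ps)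

count-fill-concat : ∀ {n} (w : Z2^ n) ps → All NonEmpty ps →
  count w (fill (concat ps)) ≡ sum (map (count w ∘ fill) ps) + count w (junctions ps)
count-fill-concat w []       [] = refl
count-fill-concat w (p ∷ []) (_ ∷ []) = begin
  count w (fill (p ++ []))  ≡⟨ cong (count w ∘ fill) (++-identityʳ p) ⟩
  count w (fill p)          ≡⟨ +-identityʳ _ ⟨
  count w (fill p) + 0      ≡⟨ +-identityʳ _ ⟨
  count w (fill p) + 0 + 0  ∎
  where open ≡-Reasoning
count-fill-concat w (p ∷ q@(y ∷ ys) ∷ ps) (p≠[] ∷ nonEmpty ∷ ps≠[]) = begin
  count w (fill (p ++ concat (q ∷ ps)))
    ≡⟨ count-fill-++ w p (concat (q ∷ ps)) p≠[] nonEmpty ⟩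
  count w (fill p) + (𝟙 (w == lastOr 𝟎 p ⊕ y) + count w (fill (concat (q ∷ ps))))
    ≡⟨ cong (λ c → count w (fill p) + (𝟙 (w == lastOr 𝟎 p ⊕ y) + c)) (count-fill-concat w (q ∷ ps) (nonEmpty ∷ ps≠[])) ⟩
  count w (fill p) + (𝟙 (w == lastOr 𝟎 p ⊕ y) + (sum (map (count w ∘ fill) (q ∷ ps)) + count w (junctions (q ∷ ps))))
    ≡⟨ shuffle (count w (fill p)) (𝟙 (w == lastOr 𝟎 p ⊕ y)) _ _ ⟩
  sum (map (count w ∘ fill) (p ∷ q ∷ ps)) + count w (junctions (p ∷ q ∷ ps)) ∎
  where
  open ≡-Reasoning
  shuffle : ∀ a j s r → a + (j + (s + r)) ≡ (a + s) + (j + r)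
  shuffle = solve-∀

-- Skeletons of ternary permutations

Triple : ∀ {n} → List (Z2^ n) → ℕ → Set
Triple xs k = lookupOr 𝟎 xs (2 * k) ⊕ lookupOr 𝟎 xs (2 * k + 1) ⊕ lookupOr 𝟎 xs (2 * k + 2) ≡ 𝟎

Triple-shift : ∀ {n} (a b : Z2^ n) xs k → Triple (a ∷ b ∷ xs) (suc k) ≡ Triple xs k
Triple-shift {n} a b xs k = cong (λ p → lookupOr 𝟎 ys p ⊕ lookupOr 𝟎 ys (p + 1) ⊕ lookupOr 𝟎 ys (p + 2) ≡ 𝟎) (*-suc 2 k)
  where
  ys : List (Z2^ n)
  ys = a ∷ b ∷ xs

fillFrom-triples : ∀ {n} (x : Z2^ n) ys k → k < length ys → Triple (fillFrom _⊕_ x ys) k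
fillFrom-triples x (y ∷ [])    zero    _         = x⊕[x⊕y]⊕y≡𝟎 x y
fillFrom-triples x (y ∷ _ ∷ _) zero    _         = x⊕[x⊕y]⊕y≡𝟎 x y
fillFrom-triples x (y ∷ ys)    (suc k) (s≤s k<n) =
  subst (λ A → A) (sym (Triple-shift x (x ⊕ y) (fillFrom _⊕_ y ys) k)) (fillFrom-triples y ys k k<n)

module _ {n : ℕ} (d : Z2^ n) where

  count-lookupOr : ∀ xs p → p < length xs → 1 ≤ count (lookupOr d xs p) xs
  count-lookupOr (x ∷ xs) zero    _         rewrite ==-refl x = s≤s z≤n
  count-lookupOr (x ∷ xs) (suc p) (s≤s p<n) = ≤-trans (count-lookupOr xs p p<n) (m≤n+m _ _)

  lookupOr-injective : ∀ xs → Distinct xs → ∀ p q → p < length xs → q < length xs →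
    lookupOr d xs p ≡ lookupOr d xs q → p ≡ q
  lookupOr-injective (x ∷ xs) once zero    zero    _         _         _  = refl
  lookupOr-injective (x ∷ xs) once zero    (suc q) _         (s≤s q<n) eq =
    ⊥-elim (twice x (subst (λ w → 1 ≤ count w xs) (sym eq) (count-lookupOr xs q q<n)) (once x))
    where
    twice : ∀ w → 1 ≤ count w xs → ¬ count w (w ∷ xs) ≤ 1
    twice w h le rewrite ==-refl w = <-irrefl refl (≤-trans (s≤s h) le)
  lookupOr-injective (x ∷ xs) once (suc p) zero    (s≤s p<n) _         eq =
    sym (lookupOr-injective (x ∷ xs) once zero (suc p) (s≤s z≤n) (s≤s p<n) (sym eq))
  lookupOr-injective (x ∷ xs) once (suc p) (suc q) (s≤s p<n) (s≤s q<n) eq =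
    cong suc (lookupOr-injective xs (λ w → ≤-trans (m≤n+m _ _) (once w)) p q p<n q<n eq)

  lookupOr-surjective : ∀ xs w → 1 ≤ count w xs → ∃ λ p → p < length xs × lookupOr d xs p ≡ w
  lookupOr-surjective (x ∷ xs) w h with w == x in eq
  ... | true  = zero , s≤s z≤n , sym (==⇒≡ w x eq)
  ... | false with lookupOr-surjective xs w h
  ...   | p , p<n , found = suc p , s≤s p<n , found

-- The odd-position terms v₁, v₃, … of a ternary permutation of F_{n+1}.
Skeleton : ℕ → Set
Skeleton n = ∃ λ (U : List (Z2^ (suc n))) → length U ≡ 2 ^ n × ListsF (fill U)

skeleton⇒sequentiallyTernary : ∀ n → Skeleton n → SequentiallyTernary (suc n)
skeleton⇒sequentiallyTernary n ([] , len , _) with () ← m^n≡0⇒m≡0 2 n (sym len)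
skeleton⇒sequentiallyTernary n (u ∷ us , len , listsF) = v , (injective , nonzero , surjective) , ternary
  where
  xs : List (Z2^ (suc n))
  xs = fillFrom _⊕_ u us

  length-xs : length xs ≡ 2 ^ suc n ∸ 1
  length-xs = begin
    length xs                 ≡⟨ length-fillFrom _⊕_ u us ⟩
    2 + 2 * length us ∸ 1     ≡⟨ cong (_∸ 1) (*-suc 2 (length us)) ⟨
    2 * suc (length us) ∸ 1   ≡⟨ cong (λ m → 2 * m ∸ 1) len ⟩
    2 ^ suc n ∸ 1             ∎
    where open ≡-Reasoning

  v : Fin (2 ^ suc n ∸ 1) → Z2^ (suc n)
  v j = lookupOr 𝟎 xs (toℕ j)

  in-range : ∀ j → toℕ j < length xs
  in-range j = subst (toℕ j <_) (sym length-xs) (toℕ<n j)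

  at-most-once : Distinct xs
  at-most-once w = subst (_≤ 1) (sym (listsF w)) (𝟙≤1 _)

  injective : ∀ {i j} → v i ≡ v j → i ≡ j
  injective {i} {j} eq = toℕ-injective
    (lookupOr-injective 𝟎 xs at-most-once (toℕ i) (toℕ j) (in-range i) (in-range j) eq)

  nonzero : ∀ j → InF (v j)
  nonzero j vj≡𝟎 = contradiction
    (subst (1 ≤_) never (subst (λ w → 1 ≤ count w xs) vj≡𝟎 (count-lookupOr 𝟎 xs (toℕ j) (in-range j)))) λ ()
    where
    never : count 𝟎 xs ≡ 0
    never = trans (listsF 𝟎) (cong (𝟙 ∘ not) (==-refl (𝟎 {suc n})))

  surjective : ∀ w → InF w → ∃ λ j → v j ≡ w
  surjective w w≢𝟎
    with lookupOr-surjective 𝟎 xs w (subst (1 ≤_) (sym (trans (listsF w) (cong (𝟙 ∘ not) (≢⇒==false w≢𝟎)))) ≤-refl)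
  ... | p , p<n , found = fromℕ< (subst (p <_) length-xs p<n) , trans (cong (lookupOr 𝟎 xs) (toℕ-fromℕ< _)) found

  ternary : IsTernary (suc n) v
  ternary k p₀ p₁ p₂ rewrite toℕ-fromℕ< p₀ | toℕ-fromℕ< p₁ | toℕ-fromℕ< p₂ = fillFrom-triples u us k k<L
    where
    2k+2<2L+1 : 2 * k + 2 < suc (2 * length us)
    2k+2<2L+1 = subst (2 * k + 2 <_) (trans (sym length-xs) (length-fillFrom _⊕_ u us)) p₂
    k<L : k < length us
    k<L = *-cancelˡ-≤ 2 (subst (_≤ 2 * length us) (trans (+-comm (2 * k) 2) (sym (*-suc 2 k))) (s≤s⁻¹ 2k+2<2L+1))

-- Little-endian binary digits: bits 3 6 = false ∷ true ∷ true ∷ [].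
bits : ∀ n → ℕ → Z2^ n
bits zero    _ = []
bits (suc n) k = (k % 2 ≡ᵇ 1) ∷ bits n (k / 2)

all? : ∀ n → (Z2^ n → Bool) → Bool
all? zero    f = f []
all? (suc n) f = all? n (f ∘ (false ∷_)) ∧ all? n (f ∘ (true ∷_))

all?-sound : ∀ n f → all? n f ≡ true → ∀ w → f w ≡ true
all?-sound zero    f h []          = h
all?-sound (suc n) f h (false ∷ w) = all?-sound n (f ∘ (false ∷_)) (∧-conicalˡ _ _ h) w
all?-sound (suc n) f h (true ∷ w)  = all?-sound n (f ∘ (true ∷_)) (∧-conicalʳ _ _ h) w

any? : ∀ n → (Z2^ n → Bool) → Bool
any? zero    f = f []
any? (suc n) f = any? n (f ∘ (false ∷_)) ∨ any? n (f ∘ (true ∷_))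

any?-complete : ∀ n f w → f w ≡ true → any? n f ≡ true
any?-complete zero    f []          h = h
any?-complete (suc n) f (false ∷ w) h = cong (_∨ any? n (f ∘ (true ∷_))) (any?-complete n (f ∘ (false ∷_)) w h)
any?-complete (suc n) f (true ∷ w)  h =
  trans (cong (any? n (f ∘ (false ∷_)) ∨_) (any?-complete n (f ∘ (true ∷_)) w h)) (∨-zeroʳ _)

≡ᵇ-sound : ∀ m n → (m ≡ᵇ n) ≡ true → m ≡ n
≡ᵇ-sound m n h = ≡ᵇ⇒≡ m n (subst T (sym h) tt)

∨-resolve : ∀ {a b} → a ∨ b ≡ true → a ≡ false → b ≡ true
∨-resolve h refl = h

listsF? : ∀ {n} → List (Z2^ n) → Bool
listsF? {n} xs = all? n (λ w → count w xs ≡ᵇ 𝟙 (not (w == 𝟎)))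

listsF?-sound : ∀ {n} (xs : List (Z2^ n)) → listsF? xs ≡ true → ListsF xs
listsF?-sound {n} xs h w = ≡ᵇ-sound _ _ (all?-sound n (λ w → count w xs ≡ᵇ 𝟙 (not (w == 𝟎))) h w)

skeleton-by-evaluation : ∀ n (U : List (Z2^ (suc n))) → length U ≡ 2 ^ n → listsF? (fill U) ≡ true → Skeleton n
skeleton-by-evaluation n U len h = U , len , listsF?-sound (fill U) h

-- The product construction, from dimension D to D + 3

IsOrdering : ∀ {p m} → Vec (Z2^ p) m → Set
IsOrdering {p} t = (l : Z2^ p) → count l (V.toList t) ≡ 1

layer : ∀ {p m D} → Fin m → List (Vec (Z2^ p) m) → List (Z2^ D) → List (Z2^ (p + D))
layer k ts vs = L.zipWith V._++_ (map (λ t → lookup t k) ts) vs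

length-layer : ∀ {p m D} (k : Fin m) (ts : List (Vec (Z2^ p) m)) (vs : List (Z2^ D)) →
  length ts ≡ length vs → length (layer k ts vs) ≡ length vs
length-layer k []       []       _  = refl
length-layer k (t ∷ ts) (v ∷ vs) eq = cong suc (length-layer k ts vs (suc-injective eq))

lastOr-layer : ∀ {p m D} (k : Fin m) (t : Vec (Z2^ p) m) ts (v : Z2^ D) vs → length ts ≡ length vs →
  lastOr 𝟎 (layer k (t ∷ ts) (v ∷ vs)) ≡ lookup (lastOr t ts) k V.++ lastOr v vs
lastOr-layer k t []        v []        _  = refl
lastOr-layer k t (t′ ∷ ts) v (v′ ∷ vs) eq = lastOr-layer k t′ ts v′ vs (suc-injective eq)

fill-layer : ∀ {p m D} (k : Fin m) t ts (v : Z2^ D) vs → length ts ≡ length vs →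
  fill (layer {p} k (t ∷ ts) (v ∷ vs)) ≡ layer k (fillFrom (V.zipWith _⊕_) t ts) (fillFrom _⊕_ v vs)
fill-layer k t ts v vs eq = begin
  fillFrom _⊕_ (lookup t k V.++ v) (L.zipWith V._++_ (map (λ s → lookup s k) ts) vs)
    ≡⟨ zipWith-fillFrom _⊕_ _⊕_ _⊕_ V._++_ (λ a a′ b b′ → sym (⊕-++ a a′ b b′)) (lookup t k) _ v vs
         (trans (length-map _ ts) eq) ⟨
  L.zipWith V._++_ (fillFrom _⊕_ (lookup t k) (map (λ s → lookup s k) ts)) (fillFrom _⊕_ v vs)
    ≡⟨ cong (λ c → L.zipWith V._++_ c (fillFrom _⊕_ v vs))
         (map-fillFrom (V.zipWith _⊕_) _⊕_ (λ s → lookup s k) (lookup-zipWith _⊕_ k) t ts) ⟨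
  layer k (fillFrom (V.zipWith _⊕_) t ts) (fillFrom _⊕_ v vs) ∎
  where open ≡-Reasoning

∑-𝟙-lookup : ∀ {p m} (t : Vec (Z2^ p) m) l b →
  ∑[ k < m ] 𝟙 ((l == lookup t k) ∧ b) ≡ 𝟙 b * count l (V.toList t)
∑-𝟙-lookup []      l b = sym (*-zeroʳ (𝟙 b))
∑-𝟙-lookup (a ∷ t) l b =
  trans (cong₂ _+_ (𝟙-∧ (l == a) b) (∑-𝟙-lookup t l b)) (sym (*-distribˡ-+ (𝟙 b) _ _))

∑-count-layer-∷ : ∀ {p m D} (l : Z2^ p) (x : Z2^ D) (t : Vec (Z2^ p) m) ts v vs →
  ∑[ k < m ] count (l V.++ x) (layer k (t ∷ ts) (v ∷ vs))
    ≡ 𝟙 (x == v) * count l (V.toList t) + ∑[ k < m ] count (l V.++ x) (layer k ts vs)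
∑-count-layer-∷ l x t ts v vs = begin
  ∑[ k < _ ] count (l V.++ x) (layer k (t ∷ ts) (v ∷ vs))
    ≡⟨ sum-cong-≗ (λ k → cong (_+ count (l V.++ x) (layer k ts vs)) (cong 𝟙 (==-++ l (lookup t k) x v))) ⟩
  ∑[ k < _ ] (𝟙 ((l == lookup t k) ∧ (x == v)) + count (l V.++ x) (layer k ts vs))
    ≡⟨ ∑-distrib-+ (λ k → 𝟙 ((l == lookup t k) ∧ (x == v))) (λ k → count (l V.++ x) (layer k ts vs)) ⟩
  ∑[ k < _ ] 𝟙 ((l == lookup t k) ∧ (x == v)) + ∑[ k < _ ] count (l V.++ x) (layer k ts vs)
    ≡⟨ cong (_+ _) (∑-𝟙-lookup t l (x == v)) ⟩
  𝟙 (x == v) * count l (V.toList t) + ∑[ k < _ ] count (l V.++ x) (layer k ts vs) ∎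
  where open ≡-Reasoning

∑-count-layer : ∀ {p m D} (l : Z2^ p) (x : Z2^ D) (ts : List (Vec (Z2^ p) m)) vs →
  All IsOrdering ts → length ts ≡ length vs → ∑[ k < m ] count (l V.++ x) (layer k ts vs) ≡ count x vs
∑-count-layer {m = m} l x []       []       []         _  = sum-replicate-zero m
∑-count-layer         l x (t ∷ ts) (v ∷ vs) (t-ord ∷ ts-ord) eq = begin
  ∑[ k < _ ] count (l V.++ x) (layer k (t ∷ ts) (v ∷ vs))
    ≡⟨ ∑-count-layer-∷ l x t ts v vs ⟩
  𝟙 (x == v) * count l (V.toList t) + ∑[ k < _ ] count (l V.++ x) (layer k ts vs)
    ≡⟨ cong₂ _+_ (trans (cong (𝟙 (x == v) *_) (t-ord l)) (*-identityʳ _)) (∑-count-layer l x ts vs ts-ord (suc-injective eq)) ⟩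
  count x (v ∷ vs) ∎
  where open ≡-Reasoning

Column : Set
Column = Vec (Z2^ 3) 8

_⊕ᶜ_ : Column → Column → Column
_⊕ᶜ_ = V.zipWith _⊕_

column : Vec ℕ 8 → Column
column = V.map (bits 3)

-- Layer k prefixes the skeleton with the k-th entries of Lcol, Mcol, Ccol, Mcol, Ccol, …, Mcol, Ccol, Rcol.
Lcol Mcol Ccol Rcol : Column
Lcol = column (0 ∷ 0 ∷ 3 ∷ 7 ∷ 6 ∷ 2 ∷ 1 ∷ 1 ∷ [])
Mcol = column (0 ∷ 2 ∷ 4 ∷ 6 ∷ 3 ∷ 1 ∷ 5 ∷ 7 ∷ [])
Ccol = column (0 ∷ 1 ∷ 2 ∷ 3 ∷ 4 ∷ 5 ∷ 7 ∷ 6 ∷ [])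
Rcol = column (0 ∷ 5 ∷ 3 ∷ 6 ∷ 7 ∷ 2 ∷ 1 ∷ 4 ∷ [])

g₁ g₂ : Z2^ 3
g₁ = bits 3 2
g₂ = bits 3 7

middleColumns : ℕ → List Column
middleColumns zero    = Rcol ∷ []
middleColumns (suc j) = Mcol ∷ Ccol ∷ middleColumns j

length-middleColumns : ∀ j → length (middleColumns j) ≡ suc (2 * j)
length-middleColumns zero    = refl
length-middleColumns (suc j) = trans (cong (2 +_) (length-middleColumns j)) (sym (cong suc (*-suc 2 j)))

lastOr-middleColumns : ∀ j → lastOr Mcol (Ccol ∷ middleColumns j) ≡ Rcol
lastOr-middleColumns zero    = refl
lastOr-middleColumns (suc j) = lastOr-middleColumns j

ordering-by-evaluation : ∀ (t : Column) → all? 3 (λ l → count l (V.toList t) ≡ᵇ 1) ≡ true → IsOrdering t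
ordering-by-evaluation t h l = ≡ᵇ-sound _ _ (all?-sound 3 (λ l → count l (V.toList t) ≡ᵇ 1) h l)

successive-sums-orderings : ∀ j → All IsOrdering (fillFrom _⊕ᶜ_ Mcol (Ccol ∷ middleColumns j))
successive-sums-orderings zero =
  ordering-by-evaluation Mcol refl ∷ ordering-by-evaluation (Mcol ⊕ᶜ Ccol) refl ∷ ordering-by-evaluation Ccol refl
  ∷ ordering-by-evaluation (Ccol ⊕ᶜ Rcol) refl ∷ ordering-by-evaluation Rcol refl ∷ []
successive-sums-orderings (suc j) =
  ordering-by-evaluation Mcol refl ∷ ordering-by-evaluation (Mcol ⊕ᶜ Ccol) refl ∷ ordering-by-evaluation Ccol refl
  ∷ ordering-by-evaluation (Ccol ⊕ᶜ Mcol) refl ∷ successive-sums-orderings j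

gadgetPrefixes cancelledPrefixes₁ cancelledPrefixes₂ zeroSuffixPrefixes uSuffixPrefixes LcolRepeats : List (Z2^ 3)
gadgetPrefixes     = g₁ ∷ g₁ ⊕ g₂ ∷ g₂ ∷ []
cancelledPrefixes₁ = lookup Rcol (# 1) ⊕ lookup Rcol (# 2) ∷ lookup Lcol (# 2) ⊕ lookup Lcol (# 3)
                   ∷ lookup Rcol (# 3) ⊕ lookup Rcol (# 4) ∷ []
cancelledPrefixes₂ = lookup Rcol (# 5) ⊕ lookup Rcol (# 6) ∷ []
zeroSuffixPrefixes = gadgetPrefixes ++ cancelledPrefixes₁ ++ cancelledPrefixes₂
uSuffixPrefixes    = lookup Lcol (# 4) ⊕ g₁ ∷ g₂ ⊕ lookup Lcol (# 5) ∷ []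
LcolRepeats        = lookup Lcol (# 1) ∷ lookup Lcol (# 7) ∷ []

zeroSuffixPrefixes-listsF : ListsF zeroSuffixPrefixes
zeroSuffixPrefixes-listsF = listsF?-sound zeroSuffixPrefixes refl

Lcol-defect : ∀ l → count l (V.toList Lcol) + count l uSuffixPrefixes ≡ 1 + count l LcolRepeats
Lcol-defect l =
  ≡ᵇ-sound _ _ (all?-sound 3 (λ l → count l (V.toList Lcol) + count l uSuffixPrefixes ≡ᵇ 1 + count l LcolRepeats) refl l)

-- Here b₀ and bᵤ record whether the suffix of l ++ x is 𝟎 or u, and c is the count of l ++ x in fill U′.
count-from-balance : ∀ l b₀ bᵤ c t → b₀ ∧ bᵤ ≡ false → 𝟙 bᵤ + t ≡ 𝟙 (not b₀) →
  c + 𝟙 bᵤ * count l LcolRepeats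
    ≡ (𝟙 bᵤ * count l (V.toList Lcol) + t) + (𝟙 b₀ * count l zeroSuffixPrefixes + 𝟙 bᵤ * count l uSuffixPrefixes) →
  c ≡ 𝟙 (not ((l == 𝟎) ∧ b₀))
count-from-balance l true  true  c t  () _
count-from-balance l true  false c .0 _  refl eq = begin
  c                                  ≡⟨ +-identityʳ c ⟨
  c + 0                              ≡⟨ eq ⟩
  count l zeroSuffixPrefixes + 0 + 0 ≡⟨ trans (+-identityʳ _) (+-identityʳ _) ⟩
  count l zeroSuffixPrefixes         ≡⟨ zeroSuffixPrefixes-listsF l ⟩
  𝟙 (not (l == 𝟎))                   ≡⟨ cong (𝟙 ∘ not) (∧-identityʳ (l == 𝟎)) ⟨
  𝟙 (not ((l == 𝟎) ∧ true))          ∎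
  where open ≡-Reasoning
count-from-balance l false true  c .0 _  refl eq = begin
  c                                  ≡⟨ +-cancelʳ-≡ (count l LcolRepeats) c 1 c+r≡1+r ⟩
  1                                  ≡⟨ cong (𝟙 ∘ not) (∧-zeroʳ (l == 𝟎)) ⟨
  𝟙 (not ((l == 𝟎) ∧ false))         ∎
  where
  open ≡-Reasoning
  c+r≡1+r : c + count l LcolRepeats ≡ 1 + count l LcolRepeats
  c+r≡1+r = begin
    c + count l LcolRepeats                                  ≡⟨ cong (c +_) (+-identityʳ _) ⟨
    c + (count l LcolRepeats + 0)                            ≡⟨ eq ⟩
    count l (V.toList Lcol) + 0 + 0 + (count l uSuffixPrefixes + 0)
      ≡⟨ cong₂ _+_ (trans (+-identityʳ _) (+-identityʳ (count l (V.toList Lcol)))) (+-identityʳ (count l uSuffixPrefixes)) ⟩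
    count l (V.toList Lcol) + count l uSuffixPrefixes    ≡⟨ Lcol-defect l ⟩
    1 + count l LcolRepeats                                  ∎
count-from-balance l false false c .1 _  refl eq = begin
  c                                  ≡⟨ +-identityʳ c ⟨
  c + 0                              ≡⟨ eq ⟩
  1                                  ≡⟨ cong (𝟙 ∘ not) (∧-zeroʳ (l == 𝟎)) ⟨
  𝟙 (not ((l == 𝟎) ∧ false))         ∎
  where open ≡-Reasoning

module ProductStep {D : ℕ} (j : ℕ) (u u₁ : Z2^ D) (us : List (Z2^ D))
            (len : length (u₁ ∷ us) ≡ length (middleColumns (suc j))) where

  U : List (Z2^ D)
  U = u ∷ u₁ ∷ us

  A B : Fin 8 → List (Z2^ (3 + D))
  A k = layer k (Lcol ∷ middleColumns (suc j)) U
  B k = layer k (middleColumns (suc j)) (u₁ ∷ us)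

  a a′ : Fin 8 → Z2^ (3 + D)
  a  k = lookup Lcol k V.++ u
  a′ k = lookup Mcol k V.++ u₁

  gadget : List (Z2^ (3 + D))
  gadget = (g₁ V.++ 𝟎) ∷ (g₂ V.++ 𝟎) ∷ []

  -- Layers 0 and 1 (and 6 and 7) start with the same element, since Lcol repeats there;
  -- gluing the reversed layer to the remainder B of the next one keeps the junction sum a ⊕ a′.
  pieces : List (List (Z2^ (3 + D)))
  pieces = reverse (A (# 0)) ∷ B (# 1) ∷ reverse (A (# 2)) ∷ A (# 3) ∷ reverse (A (# 4))
         ∷ gadget ∷ A (# 5) ∷ reverse (A (# 6)) ∷ B (# 7) ∷ []

  U′ : List (Z2^ (3 + D))
  U′ = concat pieces

  middleJunctions : List (Z2^ (3 + D))
  middleJunctions = map (V._++ 𝟎) cancelledPrefixes₁ ++ map (V._++ u) uSuffixPrefixes ++ map (V._++ 𝟎) cancelledPrefixes₂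

  len′ : length (Ccol ∷ middleColumns j) ≡ length us
  len′ = sym (suc-injective len)

  lastOr-B : ∀ k → lastOr 𝟎 (B k) ≡ lookup Rcol k V.++ lastOr u₁ us
  lastOr-B k = trans (lastOr-layer k Mcol (Ccol ∷ middleColumns j) u₁ us len′)
                     (cong (λ t → lookup t k V.++ lastOr u₁ us) (lastOr-middleColumns j))

  headOr-reverse-A : ∀ k → headOr 𝟎 (reverse (A k)) ≡ lookup Rcol k V.++ lastOr u₁ us
  headOr-reverse-A k = trans (headOr-reverse 𝟎 (A k)) (lastOr-B k)

  lastOr-reverse-A : ∀ k → lastOr 𝟎 (reverse (A k)) ≡ a k
  lastOr-reverse-A k = lastOr-reverse 𝟎 (a k) (B k)

  junctions-pieces : junctions pieces ≡ a (# 1) ⊕ a′ (# 1) ∷ middleJunctions ++ a (# 7) ⊕ a′ (# 7) ∷ []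
  junctions-pieces =
    cong₂ _∷_ j₀₁ (cong₂ _∷_ j₁₂ (cong₂ _∷_ j₂₃ (cong₂ _∷_ j₃₄
      (cong₂ _∷_ j₄g (cong₂ _∷_ jg₅ (cong₂ _∷_ j₅₆ (cong₂ _∷_ j₆₇ refl)))))))
    where
    um : Z2^ D
    um = lastOr u₁ us
    j₀₁ : lastOr 𝟎 (reverse (A (# 0))) ⊕ headOr 𝟎 (B (# 1)) ≡ a (# 1) ⊕ a′ (# 1)
    j₀₁ = cong (_⊕ a′ (# 1)) (lastOr-reverse-A (# 0))
    j₁₂ : lastOr 𝟎 (B (# 1)) ⊕ headOr 𝟎 (reverse (A (# 2))) ≡ (lookup Rcol (# 1) ⊕ lookup Rcol (# 2)) V.++ 𝟎
    j₁₂ = trans (cong₂ _⊕_ (lastOr-B (# 1)) (headOr-reverse-A (# 2))) (same-suffix (lookup Rcol (# 1)) (lookup Rcol (# 2)) um)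
    j₂₃ : lastOr 𝟎 (reverse (A (# 2))) ⊕ headOr 𝟎 (A (# 3)) ≡ (lookup Lcol (# 2) ⊕ lookup Lcol (# 3)) V.++ 𝟎
    j₂₃ = trans (cong (_⊕ a (# 3)) (lastOr-reverse-A (# 2))) (same-suffix (lookup Lcol (# 2)) (lookup Lcol (# 3)) u)
    j₃₄ : lastOr 𝟎 (A (# 3)) ⊕ headOr 𝟎 (reverse (A (# 4))) ≡ (lookup Rcol (# 3) ⊕ lookup Rcol (# 4)) V.++ 𝟎
    j₃₄ = trans (cong₂ _⊕_ (lastOr-B (# 3)) (headOr-reverse-A (# 4))) (same-suffix (lookup Rcol (# 3)) (lookup Rcol (# 4)) um)
    j₄g : lastOr 𝟎 (reverse (A (# 4))) ⊕ headOr 𝟎 gadget ≡ (lookup Lcol (# 4) ⊕ g₁) V.++ u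
    j₄g = trans (cong (_⊕ (g₁ V.++ 𝟎)) (lastOr-reverse-A (# 4))) (𝟎-suffixʳ (lookup Lcol (# 4)) g₁ u)
    jg₅ : lastOr 𝟎 gadget ⊕ headOr 𝟎 (A (# 5)) ≡ (g₂ ⊕ lookup Lcol (# 5)) V.++ u
    jg₅ = 𝟎-suffixˡ g₂ (lookup Lcol (# 5)) u
    j₅₆ : lastOr 𝟎 (A (# 5)) ⊕ headOr 𝟎 (reverse (A (# 6))) ≡ (lookup Rcol (# 5) ⊕ lookup Rcol (# 6)) V.++ 𝟎
    j₅₆ = trans (cong₂ _⊕_ (lastOr-B (# 5)) (headOr-reverse-A (# 6))) (same-suffix (lookup Rcol (# 5)) (lookup Rcol (# 6)) um)
    j₆₇ : lastOr 𝟎 (reverse (A (# 6))) ⊕ headOr 𝟎 (B (# 7)) ≡ a (# 7) ⊕ a′ (# 7)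
    j₆₇ = cong (_⊕ a′ (# 7)) (lastOr-reverse-A (# 6))

  pieces-nonEmpty : All NonEmpty pieces
  pieces-nonEmpty = reverse-nonEmpty (a (# 0)) (B (# 0)) ∷ nonEmpty ∷ reverse-nonEmpty (a (# 2)) (B (# 2)) ∷ nonEmpty
    ∷ reverse-nonEmpty (a (# 4)) (B (# 4)) ∷ nonEmpty ∷ nonEmpty ∷ reverse-nonEmpty (a (# 6)) (B (# 6)) ∷ nonEmpty ∷ []

  count-fill-U′ : ∀ w → count w (fill U′) + (𝟙 (w == a (# 1)) + 𝟙 (w == a (# 7)))
    ≡ ∑[ k < 8 ] count w (fill (A k)) + (count w (fill gadget) + count w middleJunctions)
  count-fill-U′ w = begin
    count w (fill U′) + (d (# 1) + d (# 7))
      ≡⟨ cong (_+ (d (# 1) + d (# 7))) (count-fill-concat w pieces pieces-nonEmpty) ⟩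
    Σpieces + count w (junctions pieces) + (d (# 1) + d (# 7))
      ≡⟨ cong (λ J → Σpieces + count w J + (d (# 1) + d (# 7))) junctions-pieces ⟩
    Σpieces + (e (# 1) + count w (middleJunctions ++ a (# 7) ⊕ a′ (# 7) ∷ [])) + (d (# 1) + d (# 7))
      ≡⟨ cong (λ c → Σpieces + (e (# 1) + c) + (d (# 1) + d (# 7))) (count-++ w middleJunctions (a (# 7) ⊕ a′ (# 7) ∷ [])) ⟩
    Σpieces + (e (# 1) + (M + (e (# 7) + 0))) + (d (# 1) + d (# 7))
      ≡⟨ rearrange (C′ (# 0)) (Cb (# 1)) (C′ (# 2)) (C (# 3)) (C′ (# 4)) G (C (# 5)) (C′ (# 6)) (Cb (# 7))
                   (e (# 1)) M (e (# 7)) (d (# 1)) (d (# 7)) ⟩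
    C′ (# 0) + (C (# 1) + (C′ (# 2) + (C (# 3) + (C′ (# 4) + (C (# 5) + (C′ (# 6) + (C (# 7) + 0))))))) + (G + M)
      ≡⟨ cong (_+ (G + M)) reversals ⟩
    ∑[ k < 8 ] C k + (G + M) ∎
    where
    open ≡-Reasoning
    C C′ Cb : Fin 8 → ℕ
    C  k = count w (fill (A k))
    C′ k = count w (fill (reverse (A k)))
    Cb k = count w (fill (B k))
    d e : Fin 8 → ℕ
    d k = 𝟙 (w == a k)
    e k = 𝟙 (w == a k ⊕ a′ k)
    G M Σpieces : ℕ
    G = count w (fill gadget)
    M = count w middleJunctions
    Σpieces = sum (map (count w ∘ fill) pieces)
    rearrange : ∀ c₀ b₁ c₂ c₃ c₄ g c₅ c₆ b₇ e₁ m e₇ d₁ d₇ →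
      c₀ + (b₁ + (c₂ + (c₃ + (c₄ + (g + (c₅ + (c₆ + (b₇ + 0)))))))) + (e₁ + (m + (e₇ + 0))) + (d₁ + d₇)
        ≡ c₀ + ((d₁ + (e₁ + b₁)) + (c₂ + (c₃ + (c₄ + (c₅ + (c₆ + ((d₇ + (e₇ + b₇)) + 0))))))) + (g + m)
    rearrange = solve-∀
    reversals : C′ (# 0) + (C (# 1) + (C′ (# 2) + (C (# 3) + (C′ (# 4) + (C (# 5) + (C′ (# 6) + (C (# 7) + 0)))))))
      ≡ ∑[ k < 8 ] C k
    reversals = cong₂ _+_ (r (# 0)) (cong (C (# 1) +_) (cong₂ _+_ (r (# 2)) (cong (C (# 3) +_)
                  (cong₂ _+_ (r (# 4)) (cong (C (# 5) +_) (cong₂ _+_ (r (# 6)) refl))))))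
      where
      r : ∀ k → count w (fill (reverse (A k))) ≡ count w (fill (A k))
      r k = count-fill-reverse w (A k)

  count-extras : ∀ l x → count (l V.++ x) (fill gadget) + count (l V.++ x) middleJunctions
    ≡ 𝟙 (x == 𝟎) * count l zeroSuffixPrefixes + 𝟙 (x == u) * count l uSuffixPrefixes
  count-extras l x = begin
    count w (fill gadget) + count w middleJunctions
      ≡⟨ cong₂ _+_ (cong (count w) fill-gadget) middleJunctions-count ⟩
    count w (map (V._++ 𝟎) gadgetPrefixes) + (count w (map (V._++ 𝟎) cancelledPrefixes₁)
      + (count w (map (V._++ u) uSuffixPrefixes) + count w (map (V._++ 𝟎) cancelledPrefixes₂)))
      ≡⟨ cong₂ _+_ (count-suffixed l x 𝟎 gadgetPrefixes) (cong₂ _+_ (count-suffixed l x 𝟎 cancelledPrefixes₁)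
           (cong₂ _+_ (count-suffixed l x u uSuffixPrefixes) (count-suffixed l x 𝟎 cancelledPrefixes₂))) ⟩
    b₀ * count l gadgetPrefixes + (b₀ * count l cancelledPrefixes₁ + (bᵤ * count l uSuffixPrefixes + b₀ * count l cancelledPrefixes₂))
      ≡⟨ regroup b₀ bᵤ (count l gadgetPrefixes) (count l cancelledPrefixes₁) (count l uSuffixPrefixes) (count l cancelledPrefixes₂) ⟩
    b₀ * (count l gadgetPrefixes + (count l cancelledPrefixes₁ + count l cancelledPrefixes₂)) + bᵤ * count l uSuffixPrefixes
      ≡⟨ cong (λ c → b₀ * c + bᵤ * count l uSuffixPrefixes) zeroSuffixPrefixes-count ⟨
    b₀ * count l zeroSuffixPrefixes + bᵤ * count l uSuffixPrefixes ∎
    where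
    open ≡-Reasoning
    w : Z2^ (3 + D)
    w = l V.++ x
    b₀ bᵤ : ℕ
    b₀ = 𝟙 (x == 𝟎)
    bᵤ = 𝟙 (x == u)
    middleJunctions-count : count w middleJunctions ≡ count w (map (V._++ 𝟎) cancelledPrefixes₁)
      + (count w (map (V._++ u) uSuffixPrefixes) + count w (map (V._++ 𝟎) cancelledPrefixes₂))
    middleJunctions-count =
      trans (count-++ w (map (V._++ 𝟎) cancelledPrefixes₁) (map (V._++ u) uSuffixPrefixes ++ map (V._++ 𝟎) cancelledPrefixes₂))
            (cong (count w (map (V._++ 𝟎) cancelledPrefixes₁) +_)
                  (count-++ w (map (V._++ u) uSuffixPrefixes) (map (V._++ 𝟎) cancelledPrefixes₂)))
    fill-gadget : fill gadget ≡ map (V._++ 𝟎) gadgetPrefixes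
    fill-gadget = cong (λ y → (g₁ V.++ 𝟎) ∷ y ∷ (g₂ V.++ 𝟎) ∷ []) (same-suffix g₁ g₂ 𝟎)
    zeroSuffixPrefixes-count : count l zeroSuffixPrefixes ≡ count l gadgetPrefixes + (count l cancelledPrefixes₁ + count l cancelledPrefixes₂)
    zeroSuffixPrefixes-count = trans (count-++ l gadgetPrefixes (cancelledPrefixes₁ ++ cancelledPrefixes₂))
                                     (cong (count l gadgetPrefixes +_) (count-++ l cancelledPrefixes₁ cancelledPrefixes₂))
    regroup : ∀ b₀ bᵤ g c₁ p c₂ → b₀ * g + (b₀ * c₁ + (bᵤ * p + b₀ * c₂)) ≡ b₀ * (g + (c₁ + c₂)) + bᵤ * p
    regroup = solve-∀

  ∑-count-fill-A : ∀ l x → ∑[ k < 8 ] count (l V.++ x) (fill (A k))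
    ≡ 𝟙 (x == u) * count l (V.toList Lcol) + count x (u ⊕ u₁ ∷ fillFrom _⊕_ u₁ us)
  ∑-count-fill-A l x = begin
    ∑[ k < 8 ] count w (fill (A k))
      ≡⟨ sum-cong-≗ (λ k → cong (count w) (fill-layer k Lcol (middleColumns (suc j)) u (u₁ ∷ us) (sym len))) ⟩
    ∑[ k < 8 ] count w (layer k (fillFrom _⊕ᶜ_ Lcol (middleColumns (suc j))) (fillFrom _⊕_ u (u₁ ∷ us)))
      ≡⟨ ∑-count-layer-∷ l x Lcol sums u tail-fill ⟩
    𝟙 (x == u) * count l (V.toList Lcol) + ∑[ k < 8 ] count w (layer k sums tail-fill)
      ≡⟨ cong (𝟙 (x == u) * count l (V.toList Lcol) +_)
           (∑-count-layer l x sums tail-fill (ordering-by-evaluation (Lcol ⊕ᶜ Mcol) refl ∷ successive-sums-orderings j) equal-lengths) ⟩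
    𝟙 (x == u) * count l (V.toList Lcol) + count x (u ⊕ u₁ ∷ fillFrom _⊕_ u₁ us) ∎
    where
    open ≡-Reasoning
    w : Z2^ (3 + D)
    w = l V.++ x
    sums : List Column
    sums = Lcol ⊕ᶜ Mcol ∷ fillFrom _⊕ᶜ_ Mcol (Ccol ∷ middleColumns j)
    tail-fill : List (Z2^ D)
    tail-fill = u ⊕ u₁ ∷ fillFrom _⊕_ u₁ us
    equal-lengths : length sums ≡ length tail-fill
    equal-lengths = cong suc (trans (length-fillFrom _⊕ᶜ_ Mcol (Ccol ∷ middleColumns j))
                                    (trans (cong (λ m → suc (2 * m)) len′) (sym (length-fillFrom _⊕_ u₁ us))))

  U′-listsF : ListsF (fill U) → ListsF (fill U′)
  U′-listsF listsF (c₀ ∷ c₁ ∷ c₂ ∷ x) =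
    trans (count-from-balance l (x == 𝟎) (x == u) (count w (fill U′)) (count x (u ⊕ u₁ ∷ fillFrom _⊕_ u₁ us))
                              disjoint (listsF x) balance)
          (cong (𝟙 ∘ not) (sym (==-++ l 𝟎 x 𝟎)))
    where
    open ≡-Reasoning
    l : Z2^ 3
    l = c₀ ∷ c₁ ∷ c₂ ∷ []
    w : Z2^ (3 + D)
    w = l V.++ x
    disjoint : (x == 𝟎) ∧ (x == u) ≡ false
    disjoint with x == 𝟎 in x≡𝟎 | x == u in x≡u
    ... | false | _     = refl
    ... | true  | false = refl
    ... | true  | true  =
      ⊥-elim (listsF-head≢𝟎 u (u ⊕ u₁ ∷ fillFrom _⊕_ u₁ us) listsF (trans (sym (==⇒≡ x u x≡u)) (==⇒≡ x 𝟎 x≡𝟎)))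
    balance : count w (fill U′) + 𝟙 (x == u) * count l LcolRepeats
      ≡ (𝟙 (x == u) * count l (V.toList Lcol) + count x (u ⊕ u₁ ∷ fillFrom _⊕_ u₁ us))
        + (𝟙 (x == 𝟎) * count l zeroSuffixPrefixes + 𝟙 (x == u) * count l uSuffixPrefixes)
    balance = begin
      count w (fill U′) + 𝟙 (x == u) * count l LcolRepeats
        ≡⟨ cong (count w (fill U′) +_) (count-suffixed l x u LcolRepeats) ⟨
      count w (fill U′) + (𝟙 (w == a (# 1)) + (𝟙 (w == a (# 7)) + 0))
        ≡⟨ cong (λ c → count w (fill U′) + (𝟙 (w == a (# 1)) + c)) (+-identityʳ _) ⟩
      count w (fill U′) + (𝟙 (w == a (# 1)) + 𝟙 (w == a (# 7)))
        ≡⟨ count-fill-U′ w ⟩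
      ∑[ k < 8 ] count w (fill (A k)) + (count w (fill gadget) + count w middleJunctions)
        ≡⟨ cong₂ _+_ (∑-count-fill-A l x) (count-extras l x) ⟩
      _ ∎

  length-U′ : length U′ ≡ 8 * length U
  length-U′ = begin
    length (concat pieces)  ≡⟨ length-concat pieces ⟩
    sum (map length pieces) ≡⟨ cong sum piece-lengths ⟩
    sum (suc n ∷ n ∷ suc n ∷ suc n ∷ suc n ∷ 2 ∷ suc n ∷ suc n ∷ n ∷ []) ≡⟨ total n ⟩
    8 * suc n ∎
    where
    open ≡-Reasoning
    n : ℕ
    n = length (u₁ ∷ us)
    length-B : ∀ k → length (B k) ≡ n
    length-B k = length-layer k (middleColumns (suc j)) (u₁ ∷ us) (sym len)
    length-reverse-A : ∀ k → length (reverse (A k)) ≡ suc n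
    length-reverse-A k = trans (length-reverse (A k)) (cong suc (length-B k))
    piece-lengths : map length pieces ≡ suc n ∷ n ∷ suc n ∷ suc n ∷ suc n ∷ 2 ∷ suc n ∷ suc n ∷ n ∷ []
    piece-lengths =
      cong₂ _∷_ (length-reverse-A (# 0)) (cong₂ _∷_ (length-B (# 1)) (cong₂ _∷_ (length-reverse-A (# 2))
      (cong₂ _∷_ (cong suc (length-B (# 3))) (cong₂ _∷_ (length-reverse-A (# 4)) (cong (2 ∷_)
      (cong₂ _∷_ (cong suc (length-B (# 5))) (cong₂ _∷_ (length-reverse-A (# 6)) (cong₂ _∷_ (length-B (# 7)) refl))))))))
    total : ∀ n → suc n + (n + (suc n + (suc n + (suc n + (2 + (suc n + (suc n + (n + 0)))))))) ≡ 8 * suc n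
    total = solve-∀

skeleton-step : ∀ m → Skeleton (2 + m) → Skeleton (5 + m)
skeleton-step m (U , len , listsF) = extend U len listsF
  where
  open ≡-Reasoning
  j : ℕ
  j = 2 * pred (2 ^ m)

  2^[2+m] : 2 ^ (2 + m) ≡ 1 + length (middleColumns (suc j))
  2^[2+m] = begin
    2 * (2 * 2 ^ m)                    ≡⟨ cong (λ t → 2 * (2 * t)) (suc-pred (2 ^ m) {{m^n≢0 2 m}}) ⟨
    2 * (2 * suc (pred (2 ^ m)))       ≡⟨ four (pred (2 ^ m)) ⟩
    1 + suc (2 * suc j)                ≡⟨ cong suc (length-middleColumns (suc j)) ⟨
    1 + length (middleColumns (suc j)) ∎
    where
    four : ∀ p → 2 * (2 * suc p) ≡ 1 + suc (2 * suc (2 * p))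
    four = solve-∀

  extend : (U : List (Z2^ (3 + m))) → length U ≡ 2 ^ (2 + m) → ListsF (fill U) → Skeleton (5 + m)
  extend []           len _ with () ← trans len 2^[2+m]
  extend (_ ∷ [])     len _ with () ← trans len 2^[2+m]
  extend (u ∷ u₁ ∷ us) len listsF = U′ , length-U′≡ , U′-listsF listsF
    where
    open ProductStep j u u₁ us (suc-injective (trans len 2^[2+m]))
    eight : ∀ x → 8 * x ≡ 2 * (2 * (2 * x))
    eight = solve-∀
    length-U′≡ : length U′ ≡ 2 ^ (5 + m)
    length-U′≡ = trans length-U′ (trans (cong (8 *_) len) (eight (2 ^ (2 + m))))

skeleton-1 : Skeleton 1
skeleton-1 = skeleton-by-evaluation 1 (map (bits 2) (1 ∷ 2 ∷ [])) refl refl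

skeleton-4 : Skeleton 4
skeleton-4 = skeleton-by-evaluation 4
  (map (bits 5) (1 ∷ 2 ∷ 4 ∷ 8 ∷ 5 ∷ 16 ∷ 7 ∷ 24 ∷ 9 ∷ 18 ∷ 14 ∷ 20 ∷ 10 ∷ 25 ∷ 22 ∷ 11 ∷ []))
  refl refl

skeleton-5 : Skeleton 5
skeleton-5 = skeleton-by-evaluation 5
  (map (bits 6) (1 ∷ 2 ∷ 4 ∷ 8 ∷ 5 ∷ 10 ∷ 16 ∷ 7 ∷ 9 ∷ 17 ∷ 32 ∷ 11 ∷ 18 ∷ 33 ∷ 19 ∷ 35 ∷
                 20 ∷ 40 ∷ 21 ∷ 45 ∷ 27 ∷ 53 ∷ 28 ∷ 34 ∷ 29 ∷ 58 ∷ 22 ∷ 57 ∷ 31 ∷ 59 ∷ 30 ∷ 42 ∷ []))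
  refl refl

skeleton-6 : Skeleton 6
skeleton-6 = skeleton-by-evaluation 6
  (map (bits 7) (127 ∷ 6 ∷ 41 ∷ 66 ∷ 94 ∷ 76 ∷ 1 ∷ 118 ∷ 102 ∷ 2 ∷ 111 ∷ 83 ∷ 21 ∷ 36 ∷ 48 ∷ 4 ∷
                 64 ∷ 73 ∷ 116 ∷ 105 ∷ 19 ∷ 91 ∷ 35 ∷ 17 ∷ 71 ∷ 112 ∷ 103 ∷ 22 ∷ 26 ∷ 54 ∷ 115 ∷ 74 ∷
                 24 ∷ 89 ∷ 8 ∷ 125 ∷ 15 ∷ 95 ∷ 88 ∷ 126 ∷ 97 ∷ 11 ∷ 46 ∷ 101 ∷ 96 ∷ 3 ∷ 43 ∷ 87 ∷
                 53 ∷ 93 ∷ 110 ∷ 59 ∷ 34 ∷ 78 ∷ 67 ∷ 123 ∷ 39 ∷ 10 ∷ 32 ∷ 30 ∷ 33 ∷ 27 ∷ 84 ∷ 90 ∷ []))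
  refl refl

skeleton : ∀ m → Skeleton (4 + m)
skeleton 0                   = skeleton-4
skeleton 1                   = skeleton-5
skeleton 2                   = skeleton-6
skeleton (suc (suc (suc m))) = skeleton-step (2 + m) (skeleton m)

-- No ternary permutations of F₃ and F₄

infixl 7 _·_

_·_ : ∀ {n} → Z2^ n → Z2^ n → Bool
[]      · []      = false
(a ∷ r) · (b ∷ x) = (a ∧ b) xor (r · x)

apply : ∀ {m n} → Vec (Z2^ n) m → Z2^ n → Z2^ m
apply M x = V.map (_· x) M

·-distribˡ-⊕ : ∀ {n} (r x y : Z2^ n) → r · (x ⊕ y) ≡ (r · x) xor (r · y)
·-distribˡ-⊕ []      []      []      = refl
·-distribˡ-⊕ (a ∷ r) (b ∷ x) (c ∷ y) =
  trans (cong₂ _xor_ (∧-distribˡ-xor a b c) (·-distribˡ-⊕ r x y)) (interchange (a ∧ b) (a ∧ c) (r · x) (r · y))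

·-zeroʳ : ∀ {n} (r : Z2^ n) → r · 𝟎 ≡ false
·-zeroʳ []      = refl
·-zeroʳ (a ∷ r) = cong₂ _xor_ (∧-zeroʳ a) (·-zeroʳ r)

apply-⊕ : ∀ {m n} (M : Vec (Z2^ n) m) x y → apply M (x ⊕ y) ≡ apply M x ⊕ apply M y
apply-⊕ []      x y = refl
apply-⊕ (r ∷ M) x y = cong₂ _∷_ (·-distribˡ-⊕ r x y) (apply-⊕ M x y)

apply-𝟎 : ∀ {m n} (M : Vec (Z2^ n) m) → apply M 𝟎 ≡ 𝟎
apply-𝟎 []      = refl
apply-𝟎 (r ∷ M) = cong₂ _∷_ (·-zeroʳ r) (apply-𝟎 M)

apply-injective : ∀ {m n} (M : Vec (Z2^ n) m) → (∀ x → apply M x ≡ 𝟎 → x ≡ 𝟎) → Injective _≡_ _≡_ (apply M)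
apply-injective M trivial-kernel {x} {y} Mx≡My =
  ⊕≡𝟎⇒≡ x y (trivial-kernel (x ⊕ y) (trans (apply-⊕ M x y) (trans (cong (_⊕ apply M y) Mx≡My) (⊕-self (apply M y)))))

record TernaryInjection {n : ℕ} (d : ℕ) (v : Fin (suc (2 * d)) → Z2^ n) : Set where
  field
    injective : Injective _≡_ _≡_ v
    nonzero   : ∀ j → InF (v j)
    ternary   : ∀ k (p₀ : 2 * k < suc (2 * d)) (p₁ : 2 * k + 1 < suc (2 * d)) (p₂ : 2 * k + 2 < suc (2 * d)) →
                v (fromℕ< p₀) ⊕ v (fromℕ< p₁) ⊕ v (fromℕ< p₂) ≡ 𝟎

apply-ternaryInjection : ∀ {n d v} (M : Vec (Z2^ n) n) → (∀ x → apply M x ≡ 𝟎 → x ≡ 𝟎) →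
  TernaryInjection d v → TernaryInjection d (apply M ∘ v)
apply-ternaryInjection {v = v} M trivial-kernel T = record
  { injective = λ eq → injective (apply-injective M trivial-kernel eq)
  ; nonzero   = λ j Mvj≡𝟎 → nonzero j (trivial-kernel (v j) Mvj≡𝟎)
  ; ternary   = λ k p₀ p₁ p₂ → begin
      apply M (v (fromℕ< p₀)) ⊕ apply M (v (fromℕ< p₁)) ⊕ apply M (v (fromℕ< p₂))
        ≡⟨ cong (_⊕ apply M (v (fromℕ< p₂))) (apply-⊕ M _ _) ⟨
      apply M (v (fromℕ< p₀) ⊕ v (fromℕ< p₁)) ⊕ apply M (v (fromℕ< p₂))
        ≡⟨ apply-⊕ M _ _ ⟨
      apply M (v (fromℕ< p₀) ⊕ v (fromℕ< p₁) ⊕ v (fromℕ< p₂))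
        ≡⟨ cong (apply M) (ternary k p₀ p₁ p₂) ⟩
      apply M 𝟎
        ≡⟨ apply-𝟎 M ⟩
      𝟎 ∎
  }
  where
  open TernaryInjection T
  open ≡-Reasoning

mutual
  continues? : ∀ n → ℕ → List (Z2^ n) → Z2^ n → Bool
  continues? n zero    used last = true
  continues? n (suc d) used last = any? n (extends? n d used last)

  extends? : ∀ n → ℕ → List (Z2^ n) → Z2^ n → Z2^ n → Bool
  extends? n d used last x =
    (count (last ⊕ x) used ≡ᵇ 0) ∧ (count x used ≡ᵇ 0) ∧ continues? n d (last ⊕ x ∷ x ∷ used) x

data Pairs {n : ℕ} : ℕ → Z2^ n → List (Z2^ n) → Set where
  []   : ∀ {last} → Pairs zero last []
  pair : ∀ {d last t x rs} → t ≡ last ⊕ x → Pairs d x rs → Pairs (suc d) last (t ∷ x ∷ rs)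

continues?-complete : ∀ {n} d (last : Z2^ n) rs used → Pairs d last rs → Distinct (rs ++ used) → continues? n d used last ≡ true
continues?-complete zero    last []           used []              _        = refl
continues?-complete {n} (suc d) last (t ∷ x ∷ rs) used (pair refl pairs) distinct =
  any?-complete n (extends? n d used last) x
    (cong₂ _∧_ (cong (_≡ᵇ 0) t-fresh)
      (cong₂ _∧_ (cong (_≡ᵇ 0) x-fresh) (continues?-complete d x rs (t ∷ x ∷ used) pairs distinct′)))
  where
  t-fresh : count t used ≡ 0
  t-fresh = absent-from-++ t rs used (m+n≡0⇒n≡0 (𝟙 (t == x)) (absent-after t (x ∷ rs ++ used) (distinct t)))
  x-fresh : count x used ≡ 0
  x-fresh = absent-from-++ x rs used (absent-after x (rs ++ used) (≤-trans (m≤n+m _ (𝟙 (x == t))) (distinct x)))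
  distinct′ : Distinct (rs ++ t ∷ x ∷ used)
  distinct′ w = subst (_≤ 1) moved (distinct w)
    where
    moved : count w (t ∷ x ∷ rs ++ used) ≡ count w (rs ++ t ∷ x ∷ used)
    moved = begin
      𝟙 (w == t) + (𝟙 (w == x) + count w (rs ++ used))      ≡⟨ cong (λ c → 𝟙 (w == t) + (𝟙 (w == x) + c)) (count-++ w rs used) ⟩
      𝟙 (w == t) + (𝟙 (w == x) + (count w rs + count w used)) ≡⟨ swap (𝟙 (w == t)) (𝟙 (w == x)) (count w rs) (count w used) ⟩
      count w rs + (𝟙 (w == t) + (𝟙 (w == x) + count w used)) ≡⟨ count-++ w rs (t ∷ x ∷ used) ⟨
      count w (rs ++ t ∷ x ∷ used) ∎
      where
      open ≡-Reasoning
      swap : ∀ a b c e → a + (b + (c + e)) ≡ c + (a + (b + e))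
      swap = solve-∀

triples⇒pairs : ∀ {n} d (x : Z2^ n) rs → length rs ≡ 2 * d →
  (∀ k → 2 * k + 2 ≤ length rs → Triple (x ∷ rs) k) → Pairs d x rs
triples⇒pairs zero    x []           _   _       = []
triples⇒pairs (suc d) x []           len _       with () ← trans len (*-suc 2 d)
triples⇒pairs (suc d) x (_ ∷ [])     len _       with () ← trans len (*-suc 2 d)
triples⇒pairs (suc d) x (t ∷ y ∷ rs) len triples =
  pair (middle-of-triple x t y (triples 0 (s≤s (s≤s z≤n)))) (triples⇒pairs d y rs length-rs later-triples)
  where
  length-rs : length rs ≡ 2 * d
  length-rs = suc-injective (suc-injective (trans len (*-suc 2 d)))
  later-triples : ∀ k → 2 * k + 2 ≤ length rs → Triple (y ∷ rs) k
  later-triples k le = subst (λ A → A) (Triple-shift x t (y ∷ rs) k)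
    (triples (suc k) (subst (_≤ 2 + length rs) (cong (_+ 2) (sym (*-suc 2 k))) (s≤s (s≤s le))))

tabulate-distinct : ∀ {n m} (f : Fin m → Z2^ n) → Injective _≡_ _≡_ f → (∀ j → InF (f j)) →
  ∀ w → count w (tabulate f) + 𝟙 (w == 𝟎) ≤ 1
tabulate-distinct {m = zero}  f _   _  w = 𝟙≤1 (w == 𝟎)
tabulate-distinct {n} {suc m} f inj nz w with w == f zero in w==f₀
... | false = tabulate-distinct (f ∘ suc) (λ {x} {y} eq → Fin.suc-injective (inj {suc x} {suc y} eq)) (nz ∘ suc) w
... | true  = s≤s (≤-reflexive (cong₂ _+_ (absent (f ∘ suc) w≢later) (cong 𝟙 (≢⇒==false w≢𝟎))))
  where
  w≡f₀ : w ≡ f zero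
  w≡f₀ = ==⇒≡ w (f zero) w==f₀
  w≢later : ∀ i → ¬ w ≡ f (suc i)
  w≢later i w≡fi = Fin.0≢1+n (inj {zero} {suc i} (trans (sym w≡f₀) w≡fi))
  w≢𝟎 : ¬ w ≡ 𝟎
  w≢𝟎 w≡𝟎 = nz zero (trans (sym w≡f₀) w≡𝟎)
  absent : ∀ {k} (g : Fin k → Z2^ n) → (∀ i → ¬ w ≡ g i) → count w (tabulate g) ≡ 0
  absent {zero}  g _   = refl
  absent {suc k} g w∉g = cong₂ _+_ (cong 𝟙 (≢⇒==false (w∉g zero))) (absent (g ∘ suc) (w∉g ∘ suc))

module _ {n d : ℕ} {v : Fin (suc (2 * d)) → Z2^ n} (T : TernaryInjection d v) where
  open TernaryInjection T

  tabulate-triples : ∀ k → 2 * k + 2 < suc (2 * d) → Triple (tabulate v) k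
  tabulate-triples k p₂ =
    trans (cong₂ _⊕_ (cong₂ _⊕_ (lookupOr-tabulate 𝟎 v _ p₀) (lookupOr-tabulate 𝟎 v _ p₁)) (lookupOr-tabulate 𝟎 v _ p₂))
          (ternary k p₀ p₁ p₂)
    where
    p₀ : 2 * k < suc (2 * d)
    p₀ = ≤-trans (s≤s (m≤m+n (2 * k) 2)) p₂
    p₁ : 2 * k + 1 < suc (2 * d)
    p₁ = ≤-trans (s≤s (+-monoʳ-≤ (2 * k) (s≤s z≤n))) p₂

  search-succeeds : continues? n d (v zero ∷ 𝟎 ∷ []) (v zero) ≡ true
  search-succeeds = continues?-complete d (v zero) rs (v zero ∷ 𝟎 ∷ []) pairs distinct
    where
    rs : List (Z2^ n)
    rs = tabulate (v ∘ suc)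
    length-rs : length rs ≡ 2 * d
    length-rs = length-tabulate (v ∘ suc)
    pairs : Pairs d (v zero) rs
    pairs = triples⇒pairs d (v zero) rs length-rs
              (λ k le → tabulate-triples k (s≤s (subst (2 * k + 2 ≤_) length-rs le)))
    distinct : Distinct (rs ++ v zero ∷ 𝟎 ∷ [])
    distinct w = subst (_≤ 1) rotate (tabulate-distinct v injective nonzero w)
      where
      rotate : 𝟙 (w == v zero) + count w rs + 𝟙 (w == 𝟎) ≡ count w (rs ++ v zero ∷ 𝟎 ∷ [])
      rotate = trans (rearrange (𝟙 (w == v zero)) (count w rs) (𝟙 (w == 𝟎))) (sym (count-++ w rs (v zero ∷ 𝟎 ∷ [])))
        where
        rearrange : ∀ a c z → a + c + z ≡ c + (a + (z + 0))
        rearrange = solve-∀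

refuted-by-search : ∀ {n d} {v : Fin (suc (2 * d)) → Z2^ n} → TernaryInjection d v →
  ∀ {s} → v zero ≡ s → continues? n d (s ∷ 𝟎 ∷ []) s ≡ false → ⊥
refuted-by-search T refl fails = contradiction (trans (sym (search-succeeds T)) fails) λ ()

search-fails-3 : ∀ s → InF s → continues? 3 3 (s ∷ 𝟎 ∷ []) s ≡ false
search-fails-3 s s≢𝟎 = trans (sym (not-involutive _)) (cong not (∨-resolve
  (all?-sound 3 (λ s → (s == 𝟎) ∨ not (continues? 3 3 (s ∷ 𝟎 ∷ []) s)) refl s) (≢⇒==false s≢𝟎)))

¬sequentiallyTernary-3 : ¬ SequentiallyTernary 3
¬sequentiallyTernary-3 (v , (injective , nonzero , _) , ternary) = refuted-by-search injection refl (search-fails-3 (v zero) (nonzero zero))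
  where
  injection : TernaryInjection 3 v
  injection = record { injective = injective ; nonzero = nonzero ; ternary = ternary }

value : ∀ {n} → Z2^ n → ℕ
value []      = 0
value (b ∷ x) = 𝟙 b + 2 * value x

e₁ : Z2^ 4
e₁ = bits 4 1

-- Entry (value u) lists, in binary, the rows of an invertible matrix over Z₂ sending u to e₁.
toE₁-table : List (Vec ℕ 4)
toE₁-table =
  (0 ∷ 0 ∷ 0 ∷ 0 ∷ []) ∷ (1 ∷ 12 ∷ 10 ∷ 8 ∷ []) ∷ (7 ∷ 9 ∷ 13 ∷ 8 ∷ []) ∷ (10 ∷ 3 ∷ 15 ∷ 11 ∷ []) ∷
  (6 ∷ 8 ∷ 11 ∷ 9 ∷ []) ∷ (3 ∷ 7 ∷ 15 ∷ 5 ∷ []) ∷ (11 ∷ 14 ∷ 6 ∷ 9 ∷ []) ∷ (2 ∷ 8 ∷ 11 ∷ 6 ∷ []) ∷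
  (9 ∷ 5 ∷ 7 ∷ 3 ∷ []) ∷ (5 ∷ 15 ∷ 2 ∷ 6 ∷ []) ∷ (3 ∷ 5 ∷ 4 ∷ 10 ∷ []) ∷ (8 ∷ 14 ∷ 9 ∷ 3 ∷ []) ∷
  (9 ∷ 14 ∷ 15 ∷ 2 ∷ []) ∷ (1 ∷ 9 ∷ 11 ∷ 14 ∷ []) ∷ (2 ∷ 13 ∷ 12 ∷ 6 ∷ []) ∷ (8 ∷ 12 ∷ 15 ∷ 9 ∷ []) ∷ []

toE₁ : Z2^ 4 → Vec (Z2^ 4) 4
toE₁ u = V.map (bits 4) (lookupOr (0 ∷ 0 ∷ 0 ∷ 0 ∷ []) toE₁-table (value u))

sendsToE₁Injectively : Z2^ 4 → Bool
sendsToE₁Injectively u = (apply (toE₁ u) u == e₁) ∧ all? 4 (λ x → not (apply (toE₁ u) x == 𝟎) ∨ (x == 𝟎))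

toE₁-sound : ∀ u → InF u → apply (toE₁ u) u ≡ e₁ × (∀ x → apply (toE₁ u) x ≡ 𝟎 → x ≡ 𝟎)
toE₁-sound u u≢𝟎 = ==⇒≡ _ e₁ (∧-conicalˡ _ _ checked) , trivial-kernel
  where
  checked : sendsToE₁Injectively u ≡ true
  checked = ∨-resolve (all?-sound 4 (λ u → (u == 𝟎) ∨ sendsToE₁Injectively u) refl u) (≢⇒==false u≢𝟎)
  trivial-kernel : ∀ x → apply (toE₁ u) x ≡ 𝟎 → x ≡ 𝟎
  trivial-kernel x Mx≡𝟎 = ==⇒≡ x 𝟎 (∨-resolve
    (all?-sound 4 (λ x → not (apply (toE₁ u) x == 𝟎) ∨ (x == 𝟎)) (∧-conicalʳ (apply (toE₁ u) u == e₁) _ checked) x)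
    (cong not (trans (cong (_== 𝟎) Mx≡𝟎) (==-refl (𝟎 {4})))))

¬sequentiallyTernary-4 : ¬ SequentiallyTernary 4
¬sequentiallyTernary-4 (v , (injective , nonzero , _) , ternary) =
  refuted-by-search (apply-ternaryInjection (toE₁ (v zero)) trivial-kernel injection) sends-v₀-to-e₁ search-fails
  where
  injection : TernaryInjection 7 v
  injection = record { injective = injective ; nonzero = nonzero ; ternary = ternary }
  sends-v₀-to-e₁ : apply (toE₁ (v zero)) (v zero) ≡ e₁
  sends-v₀-to-e₁ = proj₁ (toE₁-sound (v zero) (nonzero zero))
  trivial-kernel : ∀ x → apply (toE₁ (v zero)) x ≡ 𝟎 → x ≡ 𝟎
  trivial-kernel = proj₂ (toE₁-sound (v zero) (nonzero zero))
  search-fails : continues? 4 7 (e₁ ∷ 𝟎 ∷ []) e₁ ≡ false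
  search-fails = refl

mainTheorem1 : ∀ (n : ℕ) → 2 ≤ n →
    (SequentiallyTernary n ⇔ (¬ (n ≡ 3) × ¬ (n ≡ 4)))
mainTheorem1 n 2≤n = mk⇔ (λ st → (λ { refl → ¬sequentiallyTernary-3 st }) , (λ { refl → ¬sequentiallyTernary-4 st }))
                         (construction n 2≤n)
  where
  construction : ∀ n → 2 ≤ n → ¬ n ≡ 3 × ¬ n ≡ 4 → SequentiallyTernary n
  construction 1 (s≤s ()) _
  construction 2 _ _                             = skeleton⇒sequentiallyTernary 1 skeleton-1
  construction 3 _ (n≢3 , _)                     = ⊥-elim (n≢3 refl)
  construction 4 _ (_ , n≢4)                     = ⊥-elim (n≢4 refl)
  construction (suc (suc (suc (suc (suc m))))) _ _ = skeleton⇒sequentiallyTernary (4 + m) (skeleton m)
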